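{- Let $t<d-1$. Any monomial whose support contains variables from $t$ distinct compact rows survives $R_\epsilon$ with probability at most $1/n^{t}$.
   Context: Let $n=2^k$, $\mathbb{F}_n=\mathbb{F}_{2^k}$ with elements identified with $[n]$; variables $x_{i,j}$, $i,j\in[n]$, arranged in an $n\times n$ variable matrix whose $i$-th row is $\{x_{i,j}:j\in[n]\}$. Fix an $\mathbb{F}_2$-linear isomorphism $\phi:\mathbb{F}_{2^k}\to\mathbb{F}_2^k$, $[a]=\phi(a)$; for $f=\sum_{i<d}a_iZ^i$, $[f]\in\mathbb{F}_2^{kd}$ concatenates $[a_0],\dots,[a_{d-1}]$. For $i\in\mathbb{F}_n$, $\mathsf{Eval}_i$ is the $dk\times k$ matrix with $[f(i)]=[f]\cdot\mathsf{Eval}_i$, and $\overline{\mathsf{Eval}_i}$ is the $dk\times 2^k$ matrix of all $\mathbb{F}_2$-linear combinations of columns of $\mathsf{Eval}_i$. Procedure $R_\epsilon$ ($\epsilon k$ an integer): start with empty matrix $\mathcal{M}$ and empty vector $\mathcal{B}$; for $i=1,\dots,n$, repeat $\epsilon k$ times: if all columns of $\overline{\mathsf{Eval}_i}$ lie in the column span of $\mathcal{M}$ do nothing, else pick a uniformly random column of $\overline{\mathsf{Eval}_i}$ outside that span and a uniformly random $b\in\mathbb{F}_2$ and append them to $\mathcal{M}$ and $\mathcal{B}$; then set $A_i=\{v\in\mathbb{F}_2^{kd}:v\mathcal{M}=\mathcal{B}\}$. Output $S_0=\{x_{i,j}:j\neq f(i)\ \forall f\text{ with }[f]\in A_n\}$.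 A monomial survives if none of its variables is in $S_0$. Row $i$ is compact if the columns of the final $\mathcal{M}$ span every column of $\mathsf{Eval}_i$, and non-compact otherwise. -}

module Defs where

open import Data.Bool.Base using (Bool; true; false; _xor_; _∧_; not; if_then_else_)
open import Data.Bool.Properties using () renaming (_≟_ to _≟B_)
open import Data.Nat.Base using (ℕ; zero; suc; _*_; _^_; _+_)
open import Data.Fin.Base using (Fin)
open import Data.Fin.Properties using () renaming (_≟_ to _≟F_)
open import Data.Vec.Base as V using (Vec; []; _∷_)
open import Data.Vec.Properties using (≡-dec)
open import Data.List.Base as L using (List; []; _∷_; _++_; [_])
open import Data.Product.Base using (_×_; _,_; proj₁; proj₂; Σ)
open import Data.Integer.Base using (+_)
open import Data.Rational.Base using (ℚ; 0ℚ; 1ℚ; _/_) renaming (_*_ to _*ℚ_; _+_ to _+ℚ_)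
open import Relation.Nullary.Decidable.Core using (⌊_⌋)
open import Relation.Binary.PropositionalEquality using (_≡_; _≢_)
open import Algebra.Structures using (IsCommutativeRing)
open import Function.Base using (id)
open import Function.Bundles using (_↔_; Inverse)

-- F_2-vectors. Field elements of F_{2^k} are identified (via φ) with
-- their coordinate vectors [a] ∈ F_2^k; addition is coordinatewise xor.

F : ℕ → Set
F k = Vec Bool k

_⊕_ : ∀ {m} → Vec Bool m → Vec Bool m → Vec Bool m
_⊕_ = V.zipWith _xor_

0v : ∀ {m} → Vec Bool m
0v = V.replicate _ false

_≟V_ : ∀ {m} (u v : Vec Bool m) → Bool
u ≟V v = ⌊ ≡-dec _≟B_ u v ⌋

dot : ∀ {m} → Vec Bool m → Vec Bool m → Bool
dot u v = V.foldr _ _xor_ false (V.zipWith _∧_ u v)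

allB : ∀ {A : Set} → (A → Bool) → List A → Bool
allB p = L.foldr (λ a b → p a ∧ b) true

anyB : ∀ {A : Set} → (A → Bool) → List A → Bool
anyB p = L.foldr (λ a b → p a Data.Bool.Base.∨ b) false

allVecOf : ∀ {A : Set} → List A → (m : ℕ) → List (Vec A m)
allVecOf xs zero    = [ [] ]
allVecOf xs (suc m) = L.concatMap (λ x → L.map (x ∷_) (allVecOf xs m)) xs

allVec : (m : ℕ) → List (Vec Bool m)
allVec = allVecOf (false ∷ true ∷ [])

-- A field structure with 2^k elements on F_2^k (addition = xor,
-- negation = identity since the characteristic is 2).

record GF2k (k : ℕ) : Set where
  field
    _·_        : F k → F k → F k
    𝟙          : F k
    isCommRing : IsCommutativeRing _≡_ _⊕_ _·_ id 0v 𝟙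
    𝟙≢0        : 𝟙 ≢ 0v
    inverse    : ∀ a → a ≢ 0v → Σ (F k) (λ b → a · b ≡ 𝟙)

-- Polynomials of degree < d: f = Σ_{i<d} a_i Z^i as coefficient vector.

Poly : ℕ → ℕ → Set
Poly k d = Vec (F k) d

module Field {k : ℕ} (G : GF2k k) where
  open GF2k G

  evalP : ∀ {d} → Poly k d → F k → F k
  evalP []       x = 0v
  evalP (a ∷ as) x = a ⊕ (x · evalP as x)

  -- [f] ∈ F_2^{kd}: concatenation of [a_0], ..., [a_{d-1}]
  enc : ∀ {d} → Poly k d → Vec Bool (d * k)
  enc = V.concat

  dec : ∀ {d} → Vec Bool (d * k) → Poly k d
  dec {zero}  v = []
  dec {suc d} v = V.take k v ∷ dec {d} (V.drop k v)

  unitV : ∀ {m} → Fin m → Vec Bool m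
  unitV p = V.tabulate (λ q → ⌊ p ≟F q ⌋)

  -- column c of the dk × k matrix Eval_i, i.e. [f(i)]_c = [f] · Evalcol i c
  EvalCol : ∀ d → F k → Fin k → Vec Bool (d * k)
  EvalCol d i c = V.tabulate (λ p → V.lookup (evalP (dec {d} (unitV p)) i) c)

  -- column s (s ∈ F_2^k) of the dk × 2^k matrix overline(Eval_i):
  -- the F_2-linear combination Σ_c s_c · (column c of Eval_i)
  EvalBarCol : ∀ d → F k → Vec Bool k → Vec Bool (d * k)
  EvalBarCol d i s = V.tabulate (λ p → dot (evalP (dec {d} (unitV p)) i) s)

  EvalBarCols : ∀ d → F k → List (Vec Bool (d * k))
  EvalBarCols d i = L.map (EvalBarCol d i) (allVec k)

spanL : ∀ {m} → List (Vec Bool m) → List (Vec Bool m)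
spanL []       = [ 0v ]
spanL (c ∷ cs) = spanL cs ++ L.map (c ⊕_) (spanL cs)

inSpan : ∀ {m} → List (Vec Bool m) → Vec Bool m → Bool
inSpan cs v = anyB (_≟V v) (spanL cs)

Dist : Set → Set
Dist A = List (ℚ × A)

ret : ∀ {A} → A → Dist A
ret a = [ (1ℚ , a) ]

bind : ∀ {A B} → Dist A → (A → Dist B) → Dist B
bind D f = L.concatMap (λ pa → L.map (λ qb → (proj₁ pa *ℚ proj₁ qb , proj₂ qb)) (f (proj₂ pa))) D

uniform : ∀ {A} → A → List A → Dist A
uniform x xs = L.map (λ a → ((+ 1) / suc (L.length xs) , a)) (x ∷ xs)

Pr : ∀ {A} → Dist A → (A → Bool) → ℚ
Pr D P = L.foldr (λ pa acc → (if P (proj₂ pa) then proj₁ pa else 0ℚ) +ℚ acc) 0ℚ D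

-- The procedure R_ε.  The state is the list of pairs (column of 𝓜, entry
-- of 𝓑); r = εk is the number of repetitions per row.

State : ℕ → Set
State m = List (Vec Bool m × Bool)

colsOf : ∀ {m} → State m → List (Vec Bool m)
colsOf = L.map proj₁

extend : ∀ {m} → State m → List (Vec Bool m) → Dist (State m)
extend st []       = ret st
extend st (c ∷ cs) =
  bind (uniform c cs) λ col →
  bind (uniform false (true ∷ [])) λ b →
  ret (st ++ [ (col , b) ])

module Procedure {k : ℕ} (G : GF2k k) (d : ℕ) where
  open Field G

  step : F k → State (d * k) → Dist (State (d * k))
  step i st = extend st (L.filterᵇ (λ c → not (inSpan (colsOf st) c)) (EvalBarCols d i))

  repeatStep : ℕ → F k → State (d * k) → Dist (State (d * k))
  repeatStep zero    i st = ret st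
  repeatStep (suc r) i st = bind (step i st) (repeatStep r i)

  runRows : ℕ → List (F k) → State (d * k) → Dist (State (d * k))
  runRows r []       st = ret st
  runRows r (i ∷ is) st = bind (repeatStep r i st) (runRows r is)

  -- ι identifies [n] = Fin (2^k) with F_{2^k}; rows processed i = 1, ..., n
  R : (ι : Fin (2 ^ k) ↔ F k) → (r : ℕ) → Dist (State (d * k))
  R ι r = runRows r (L.map (Inverse.to ι) (L.allFin (2 ^ k))) []

  -- v ∈ A_n  iff  v 𝓜 = 𝓑
  inA : State (d * k) → Vec Bool (d * k) → Bool
  inA st v = allB (λ mb → dot v (proj₁ mb) ≟V? proj₂ mb) st
    where
    _≟V?_ : Bool → Bool → Bool
    a ≟V? b = ⌊ a ≟B b ⌋

  -- x_{i,j} ∉ S_0  iff  some f with [f] ∈ A_n has f(i) = j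
  notInS0 : State (d * k) → F k → F k → Bool
  notInS0 st i j = anyB (λ f → inA st (enc f) ∧ (evalP f i ≟V j)) (allVecOf (allVec k) d)

  -- a monomial is given by its exponent function on the variables x_{i,j},
  -- i, j ∈ [n]; it survives iff no variable of its support lies in S_0
  survives : (ι : Fin (2 ^ k) ↔ F k) → (Fin (2 ^ k) → Fin (2 ^ k) → ℕ) → State (d * k) → Bool
  survives ι m st =
    allB (λ i → allB (λ j → isZero (m i j) Data.Bool.Base.∨ notInS0 st (Inverse.to ι i) (Inverse.to ι j))
                       (L.allFin (2 ^ k)))
          (L.allFin (2 ^ k))
    where
    isZero : ℕ → Bool
    isZero zero    = true
    isZero (suc _) = false

  compact : State (d * k) → F k → Bool
  compact st i = allB (λ c → inSpan (colsOf st) (EvalCol d i c)) (L.allFin k)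

  allCompact : (ι : Fin (2 ^ k) ↔ F k) → List (Fin (2 ^ k)) → State (d * k) → Bool
  allCompact ι T st = allB (λ i → compact st (Inverse.to ι i)) T

-- Conditionally on the columns 𝓜, the bits 𝓑 are independent fair coins, so for every fixed w the
-- run is invariant in distribution under 𝓑 ↦ 𝓑 ⊕ w𝓜, which translates A_n by w.  On a compact row
-- i all [f] ∈ A_n agree at i; if the monomial survives, this common value f(i) is a j with x_{i,j}
-- in its support.  As t < d, every tuple of values on the rows T is attained by a polynomial W of
-- degree < d, and shifting by [W] translates the forced values by that tuple.  Hence for each state
-- at most one of the n^t shifted events "survives and T compact" holds, each shifted event is as
-- likely as the unshifted one, and all of them lie inside "T compact".

module Submission where

open import Defs
open import Algebra.Bundles using (CommutativeRing)
import Algebra.Properties.CommutativeSemigroup as CommutativeSemigroupProperties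
import Algebra.Properties.Group as GroupProperties
open import Data.Bool.Base using (Bool; true; false; T; _xor_; _∧_; not)
open import Data.Bool.Properties
  using (T-∧; T-∨; xor-assoc; xor-same; xor-identityʳ; ∧-comm; ∧-distribʳ-xor; xor-∧-commutativeRing)
open import Data.Empty using (⊥-elim)
open import Data.Fin.Base as Fin using (Fin)
open import Data.Fin.Properties using (suc-injective) renaming (_≟_ to _≟F_)
import Data.Integer.Base as ℤ
open import Data.Integer.Base using (+_)
import Data.Integer.Properties as ℤ
open import Data.List.Base as L using (List; []; _∷_; _++_; [_]; length; cartesianProductWith)
open import Data.List.Properties using (length-map; length-++; map-++)
open import Data.List.Membership.Propositional using (_∈_)
open import Data.List.Membership.Propositional.Properties using (∈-allFin)
open import Data.List.Relation.Unary.All as All using (All; []; _∷_)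
import Data.List.Relation.Unary.All.Properties as All
open import Data.List.Relation.Unary.Any using (Any; here; there; satisfied)
open import Data.List.Relation.Unary.Unique.Propositional using (Unique; []; _∷_)
import Data.List.Relation.Unary.Unique.Propositional.Properties as Unique
import Data.Nat.Base as ℕ
open import Data.Nat.Base using (ℕ; zero; suc; _^_; _∸_; _<_; z≤n; s≤s)
import Data.Nat.Coprimality as Coprimality
import Data.Nat.Properties as ℕ
open import Data.Product.Base using (_×_; _,_; proj₁; proj₂; ∃; Σ-syntax)
open import Data.Sum.Base using (inj₁; inj₂)
open import Data.Rational.Base using (ℚ; 0ℚ; 1ℚ; _≤_; _*_; _+_; _/_; NonNegative)
import Data.Rational.Properties as ℚ
open import Data.Rational.Solver using (module +-*-Solver)
open import Data.Vec.Base as V using (Vec; []; _∷_)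
import Data.Vec.Properties as V
open import Function.Base using (_∘_)
open import Function.Bundles using (_↔_; Inverse; Injection; Equivalence)
open import Function.Properties.Inverse using (↔⇒↣)
open import Relation.Binary.PropositionalEquality hiding ([_])
open import Relation.Nullary using (¬_)
open import Relation.Nullary.Decidable using (⌊_⌋; ⌊⌋-map′; toWitness)

open +-*-Solver
open Equivalence using (to)

private
  variable
    A B C : Set
    m : ℕ

fromℕ : ℕ → ℚ
fromℕ n = + n / 1

-- normalize-coprime exposes the normal form mkℚ (+ n) 0 _, on which _+_ computes
fromℕ-suc : ∀ n → fromℕ (suc n) ≡ 1ℚ + fromℕ n
fromℕ-suc n rewrite ℚ.normalize-coprime (Coprimality.sym (Coprimality.1-coprimeTo n)) =
  sym (ℚ./-cong {p₁ = + 1 ℤ.* + 1 ℤ.+ + n ℤ.* + 1} {q₁ = 1} (cong (ℤ._+_ (+ 1)) (ℤ.*-identityʳ (+ n))) refl)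

T-allB : (p : A → Bool) (xs : List A) → T (allB p xs) → All (T ∘ p) xs
T-allB p []       _ = []
T-allB p (x ∷ xs) h = proj₁ (to T-∧ h) ∷ T-allB p xs (proj₂ (to T-∧ h))

T-anyB : (p : A → Bool) (xs : List A) → T (anyB p xs) → Any (T ∘ p) xs
T-anyB p (x ∷ xs) h with to (T-∨ {p x}) h
... | inj₁ px  = here px
... | inj₂ pxs = there (T-anyB p xs pxs)

T-≟V : ∀ {u v : Vec Bool m} → T (u ≟V v) → u ≡ v
T-≟V = toWitness

-- Expectation under a finite distribution

𝔼 : Dist A → (A → ℚ) → ℚ
𝔼 []            g = 0ℚ
𝔼 ((q , a) ∷ D) g = q * g a + 𝔼 D g

indicator : Bool → ℚ
indicator true  = 1ℚ
indicator false = 0ℚ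

Pr≡𝔼-indicator : (D : Dist A) (P : A → Bool) → Pr D P ≡ 𝔼 D (indicator ∘ P)
Pr≡𝔼-indicator []            P = refl
Pr≡𝔼-indicator ((q , a) ∷ D) P with P a
... | true  = cong₂ _+_ (sym (ℚ.*-identityʳ q)) (Pr≡𝔼-indicator D P)
... | false = cong₂ _+_ (sym (ℚ.*-zeroʳ q)) (Pr≡𝔼-indicator D P)

𝔼-cong : (D : Dist A) {g h : A → ℚ} → (∀ a → g a ≡ h a) → 𝔼 D g ≡ 𝔼 D h
𝔼-cong []            g≗h = refl
𝔼-cong ((q , a) ∷ D) g≗h = cong₂ _+_ (cong (q *_) (g≗h a)) (𝔼-cong D g≗h)

𝔼-ret : (a : A) (g : A → ℚ) → 𝔼 (ret a) g ≡ g a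
𝔼-ret a g = trans (ℚ.+-identityʳ _) (ℚ.*-identityˡ _)

𝔼-++ : (D E : Dist A) (g : A → ℚ) → 𝔼 (D ++ E) g ≡ 𝔼 D g + 𝔼 E g
𝔼-++ []            E g = sym (ℚ.+-identityˡ _)
𝔼-++ ((q , a) ∷ D) E g =
  trans (cong (_+_ (q * g a)) (𝔼-++ D E g)) (sym (ℚ.+-assoc (q * g a) (𝔼 D g) (𝔼 E g)))

𝔼-reweight : (q : ℚ) (D : Dist A) (g : A → ℚ) →
             𝔼 (L.map (λ pa → (q * proj₁ pa , proj₂ pa)) D) g ≡ q * 𝔼 D g
𝔼-reweight q []            g = sym (ℚ.*-zeroʳ q)
𝔼-reweight q ((p , a) ∷ D) g = trans (cong (_+_ (q * p * g a)) (𝔼-reweight q D g))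
  (solve 4 (λ q p x y → (q :* p) :* x :+ q :* y := q :* (p :* x :+ y)) refl q p (g a) (𝔼 D g))

𝔼-bind : (D : Dist A) (f : A → Dist B) (g : B → ℚ) → 𝔼 (bind D f) g ≡ 𝔼 D (λ a → 𝔼 (f a) g)
𝔼-bind []            f g = refl
𝔼-bind ((q , a) ∷ D) f g = trans (𝔼-++ (L.map (λ pb → (q * proj₁ pb , proj₂ pb)) (f a)) _ g)
  (cong₂ _+_ (𝔼-reweight q (f a) g) (𝔼-bind D f g))

𝔼-+ : (D : Dist A) (g h : A → ℚ) → 𝔼 D (λ a → g a + h a) ≡ 𝔼 D g + 𝔼 D h
𝔼-+ []            g h = refl
𝔼-+ ((q , a) ∷ D) g h = trans (cong (_+_ (q * (g a + h a))) (𝔼-+ D g h))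
  (solve 5 (λ q x y u v → q :* (x :+ y) :+ (u :+ v) := (q :* x :+ u) :+ (q :* y :+ v))
         refl q (g a) (h a) (𝔼 D g) (𝔼 D h))

𝔼-0 : (D : Dist A) → 𝔼 D (λ _ → 0ℚ) ≡ 0ℚ
𝔼-0 []            = refl
𝔼-0 ((q , a) ∷ D) = cong₂ _+_ (ℚ.*-zeroʳ q) (𝔼-0 D)

NonNegWeights : Dist A → Set
NonNegWeights = All (NonNegative ∘ proj₁)

𝔼-mono : (D : Dist A) {g h : A → ℚ} → NonNegWeights D → (∀ a → g a ≤ h a) → 𝔼 D g ≤ 𝔼 D h
𝔼-mono []            _          g≤h = ℚ.≤-refl
𝔼-mono ((q , a) ∷ D) (q≥0 ∷ D≥0) g≤h =
  ℚ.+-mono-≤ (ℚ.*-monoˡ-≤-nonNeg q {{q≥0}} (g≤h a)) (𝔼-mono D D≥0 g≤h)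

ret-nonNeg : (a : A) → NonNegWeights (ret a)
ret-nonNeg a = _ ∷ []

bind-nonNeg : (D : Dist A) (f : A → Dist B) →
              NonNegWeights D → (∀ a → NonNegWeights (f a)) → NonNegWeights (bind D f)
bind-nonNeg []            f []          f≥0 = []
bind-nonNeg ((q , a) ∷ D) f (q≥0 ∷ D≥0) f≥0 = All.++⁺ (reweight (f a) (f≥0 a)) (bind-nonNeg D f D≥0 f≥0)
  where
  reweight : (E : Dist B) → NonNegWeights E → NonNegWeights (L.map (λ pb → (q * proj₁ pb , proj₂ pb)) E)
  reweight []            []          = []
  reweight ((p , b) ∷ E) (p≥0 ∷ E≥0) = ℚ.nonNeg*nonNeg⇒nonNeg q {{q≥0}} p {{p≥0}} ∷ reweight E E≥0

uniform-nonNeg : (x : A) (xs : List A) → NonNegWeights (uniform x xs)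
uniform-nonNeg x xs = All.map⁺ (All.universal (λ _ → ℚ.normalize-nonNeg 1 (suc (length xs))) (x ∷ xs))

∑ : List A → (A → ℚ) → ℚ
∑ []       f = 0ℚ
∑ (x ∷ xs) f = f x + ∑ xs f

∑-cong : (xs : List A) {f g : A → ℚ} → (∀ x → f x ≡ g x) → ∑ xs f ≡ ∑ xs g
∑-cong []       f≗g = refl
∑-cong (x ∷ xs) f≗g = cong₂ _+_ (f≗g x) (∑-cong xs f≗g)

∑-const : (xs : List A) (c : ℚ) → ∑ xs (λ _ → c) ≡ fromℕ (length xs) * c
∑-const []       c = sym (ℚ.*-zeroˡ c)
∑-const (x ∷ xs) c = begin
  c + ∑ xs (λ _ → c)                ≡⟨ cong (_+_ c) (∑-const xs c) ⟩
  c + fromℕ (length xs) * c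
    ≡⟨ solve 2 (λ c u → c :+ u :* c := (con 1ℚ :+ u) :* c) refl c (fromℕ (length xs)) ⟩
  (1ℚ + fromℕ (length xs)) * c      ≡⟨ cong (_* c) (sym (fromℕ-suc (length xs))) ⟩
  fromℕ (suc (length xs)) * c       ∎
  where open ≡-Reasoning

𝔼-∑ : (D : Dist A) (xs : List B) (h : B → A → ℚ) →
      𝔼 D (λ a → ∑ xs (λ x → h x a)) ≡ ∑ xs (λ x → 𝔼 D (h x))
𝔼-∑ D []       h = 𝔼-0 D
𝔼-∑ D (x ∷ xs) h = trans (𝔼-+ D (h x) (λ a → ∑ xs (λ y → h y a))) (cong (_+_ (𝔼 D (h x))) (𝔼-∑ D xs h))

∑-indicator-none : (b : A → Bool) (xs : List A) → All (λ x → ¬ T (b x)) xs → ∑ xs (indicator ∘ b) ≡ 0ℚ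
∑-indicator-none b []       []          = refl
∑-indicator-none b (x ∷ xs) (¬bx ∷ ¬bxs) with b x
... | true  = ⊥-elim (¬bx _)
... | false = trans (ℚ.+-identityˡ _) (∑-indicator-none b xs ¬bxs)

∑-indicator≤1 : (b : A → Bool) (xs : List A) → Unique xs →
                (∀ {x y} → T (b x) → T (b y) → x ≡ y) → ∑ xs (indicator ∘ b) ≤ 1ℚ
∑-indicator≤1 b []       []           _   = ℚ.nonNegative⁻¹ 1ℚ
∑-indicator≤1 b (x ∷ xs) (x∉xs ∷ !xs) one with b x in bx
... | false = ℚ.≤-trans (ℚ.≤-reflexive (ℚ.+-identityˡ _)) (∑-indicator≤1 b xs !xs one)
... | true  = ℚ.≤-reflexive (trans (cong (_+_ 1ℚ) (∑-indicator-none b xs (All.map ¬by x∉xs))) (ℚ.+-identityʳ 1ℚ))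
  where
  ¬by : ∀ {y} → x ≢ y → ¬ T (b y)
  ¬by x≢y by = x≢y (one (subst T (sym bx) _) by)

concatMap≡cartesianProductWith : (f : A → B → C) (xs : List A) (ys : List B) →
  L.concatMap (λ x → L.map (f x) ys) xs ≡ cartesianProductWith f xs ys
concatMap≡cartesianProductWith f []       ys = refl
concatMap≡cartesianProductWith f (x ∷ xs) ys = cong (L.map (f x) ys ++_) (concatMap≡cartesianProductWith f xs ys)

allVecOf-suc : (xs : List A) (t : ℕ) → allVecOf xs (suc t) ≡ cartesianProductWith _∷_ xs (allVecOf xs t)
allVecOf-suc xs t = concatMap≡cartesianProductWith _∷_ xs (allVecOf xs t)

length-cartesianProductWith : (f : A → B → C) (xs : List A) (ys : List B) →
  length (cartesianProductWith f xs ys) ≡ length xs ℕ.* length ys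
length-cartesianProductWith f []       ys = refl
length-cartesianProductWith f (x ∷ xs) ys = begin
  length (L.map (f x) ys ++ cartesianProductWith f xs ys)
    ≡⟨ length-++ (L.map (f x) ys) ⟩
  length (L.map (f x) ys) ℕ.+ length (cartesianProductWith f xs ys)
    ≡⟨ cong₂ ℕ._+_ (length-map (f x) ys) (length-cartesianProductWith f xs ys) ⟩
  length ys ℕ.+ length xs ℕ.* length ys
    ∎
  where open ≡-Reasoning

length-allVecOf : (xs : List A) (t : ℕ) → length (allVecOf xs t) ≡ length xs ^ t
length-allVecOf xs zero    = refl
length-allVecOf xs (suc t) = begin
  length (allVecOf xs (suc t))                            ≡⟨ cong length (allVecOf-suc xs t) ⟩
  length (cartesianProductWith _∷_ xs (allVecOf xs t))    ≡⟨ length-cartesianProductWith _∷_ xs _ ⟩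
  length xs ℕ.* length (allVecOf xs t)                    ≡⟨ cong (length xs ℕ.*_) (length-allVecOf xs t) ⟩
  length xs ℕ.* length xs ^ t                             ∎
  where open ≡-Reasoning

allVecOf-unique : (xs : List A) (t : ℕ) → Unique xs → Unique (allVecOf xs t)
allVecOf-unique xs zero    !xs = [] ∷ []
allVecOf-unique xs (suc t) !xs = subst Unique (sym (allVecOf-suc xs t))
  (Unique.cartesianProductWith⁺ _∷_ V.∷-injective !xs (allVecOf-unique xs t !xs))

-- Linear algebra over F₂

open CommutativeSemigroupProperties (CommutativeRing.+-commutativeSemigroup xor-∧-commutativeRing)
  using () renaming (interchange to xor-interchange)

xor-cancelʳ : ∀ a b → (a xor b) xor b ≡ a
xor-cancelʳ a b = trans (xor-assoc a b b) (trans (cong (a xor_) (xor-same b)) (xor-identityʳ a))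

⊕-identityˡ : (v : Vec Bool m) → 0v ⊕ v ≡ v
⊕-identityˡ = V.zipWith-identityˡ (λ _ → refl)

dot-⊕ˡ : (u v c : Vec Bool m) → dot (u ⊕ v) c ≡ dot u c xor dot v c
dot-⊕ˡ []      []      []      = refl
dot-⊕ˡ (a ∷ u) (b ∷ v) (x ∷ c) = trans (cong₂ _xor_ (∧-distribʳ-xor x a b) (dot-⊕ˡ u v c))
  (xor-interchange (a ∧ x) (b ∧ x) (dot u c) (dot v c))

dot-comm : (u v : Vec Bool m) → dot u v ≡ dot v u
dot-comm []      []      = refl
dot-comm (a ∷ u) (b ∷ v) = cong₂ _xor_ (∧-comm a b) (dot-comm u v)

dot-⊕ʳ : (z u v : Vec Bool m) → dot z (u ⊕ v) ≡ dot z u xor dot z v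
dot-⊕ʳ z u v = trans (dot-comm z (u ⊕ v)) (trans (dot-⊕ˡ u v z) (cong₂ _xor_ (dot-comm u z) (dot-comm v z)))

dot-zeroʳ : (u : Vec Bool m) → dot u 0v ≡ false
dot-zeroʳ []          = refl
dot-zeroʳ (true  ∷ u) = dot-zeroʳ u
dot-zeroʳ (false ∷ u) = dot-zeroʳ u

-- definitionally Field.unitV, so EvalCol d x c is tabulate (ℓ ∘ unitVec) for ℓ v = (evalP (dec v) x)_c
unitVec : Fin m → Vec Bool m
unitVec p = V.tabulate (λ q → ⌊ p ≟F q ⌋)

tabulate-false : V.tabulate (λ (_ : Fin m) → false) ≡ 0v
tabulate-false {zero}  = refl
tabulate-false {suc m} = cong (false ∷_) tabulate-false

unitVec-zero : unitVec {suc m} Fin.zero ≡ true ∷ 0v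
unitVec-zero = cong (true ∷_) tabulate-false

unitVec-suc : (p : Fin m) → unitVec (Fin.suc p) ≡ false ∷ unitVec p
unitVec-suc p = cong (false ∷_) (V.tabulate-cong (λ q → ⌊⌋-map′ (cong Fin.suc) suc-injective (p ≟F q)))

Additive : (Vec Bool m → Bool) → Set
Additive ℓ = ∀ u v → ℓ (u ⊕ v) ≡ ℓ u xor ℓ v

additive-zero : (ℓ : Vec Bool m → Bool) → Additive ℓ → ℓ 0v ≡ false
additive-zero ℓ ℓ-⊕ = begin
  ℓ 0v              ≡⟨ cong ℓ (⊕-identityˡ 0v) ⟨
  ℓ (0v ⊕ 0v)       ≡⟨ ℓ-⊕ 0v 0v ⟩
  ℓ 0v xor ℓ 0v     ≡⟨ xor-same (ℓ 0v) ⟩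
  false             ∎
  where open ≡-Reasoning

additive⇒dot : (ℓ : Vec Bool m → Bool) → Additive ℓ → ∀ v → ℓ v ≡ dot v (V.tabulate (ℓ ∘ unitVec))
additive⇒dot ℓ ℓ-⊕ []      = additive-zero ℓ ℓ-⊕
additive⇒dot ℓ ℓ-⊕ (b ∷ v) = begin
  ℓ (b ∷ v)                                                ≡⟨ cong ℓ split ⟨
  ℓ ((b ∷ 0v) ⊕ (false ∷ v))                               ≡⟨ ℓ-⊕ (b ∷ 0v) (false ∷ v) ⟩
  ℓ (b ∷ 0v) xor ℓ (false ∷ v)                             ≡⟨ cong₂ _xor_ (head b) (additive⇒dot ℓ′ ℓ′-⊕ v) ⟩
  (b ∧ ℓ (unitVec Fin.zero)) xor dot v (V.tabulate (ℓ′ ∘ unitVec))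
    ≡⟨ cong (λ z → (b ∧ ℓ (unitVec Fin.zero)) xor dot v z)
            (V.tabulate-cong (λ p → cong ℓ (sym (unitVec-suc p)))) ⟩
  dot (b ∷ v) (V.tabulate (ℓ ∘ unitVec))                   ∎
  where
  open ≡-Reasoning
  ℓ′ : Vec Bool _ → Bool
  ℓ′ u = ℓ (false ∷ u)
  ℓ′-⊕ : Additive ℓ′
  ℓ′-⊕ u w = ℓ-⊕ (false ∷ u) (false ∷ w)
  split : (b ∷ 0v) ⊕ (false ∷ v) ≡ b ∷ v
  split = cong₂ _∷_ (xor-identityʳ b) (⊕-identityˡ v)
  head : ∀ b → ℓ (b ∷ 0v) ≡ b ∧ ℓ (unitVec Fin.zero)
  head true  = cong ℓ (sym unitVec-zero)
  head false = additive-zero ℓ ℓ-⊕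

lookup-false⇒0v : (v : Vec Bool m) → (∀ c → V.lookup v c ≡ false) → v ≡ 0v
lookup-false⇒0v v v[c]≡false =
  trans (sym (V.tabulate∘lookup v)) (trans (V.tabulate-cong v[c]≡false) tabulate-false)

_⟂_ : Vec Bool m → List (Vec Bool m) → Set
z ⟂ cs = All (λ c → dot z c ≡ false) cs

⟂-spanL : (z : Vec Bool m) (cs : List (Vec Bool m)) → z ⟂ cs → z ⟂ spanL cs
⟂-spanL z []       []            = dot-zeroʳ z ∷ []
⟂-spanL z (c ∷ cs) (z⟂c ∷ z⟂cs) =
  All.++⁺ z⟂span (All.map⁺ (All.map (λ {s} z⟂s → trans (dot-⊕ʳ z c s) (cong₂ _xor_ z⟂c z⟂s)) z⟂span))
  where
  z⟂span : z ⟂ spanL cs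
  z⟂span = ⟂-spanL z cs z⟂cs

⟂-inSpan : (z : Vec Bool m) (cs : List (Vec Bool m)) (v : Vec Bool m) →
           z ⟂ cs → T (inSpan cs v) → dot z v ≡ false
⟂-inSpan z cs v z⟂cs v∈span = orthogonal (⟂-spanL z cs z⟂cs) (T-anyB (_≟V v) (spanL cs) v∈span)
  where
  orthogonal : ∀ {ss} → z ⟂ ss → Any (λ s → T (s ≟V v)) ss → dot z v ≡ false
  orthogonal (z⟂s ∷ _)   (here s≡v) rewrite T-≟V s≡v = z⟂s
  orthogonal (_ ∷ z⟂ss) (there v∈ss) = orthogonal z⟂ss v∈ss

take-drop-++ : ∀ {n} (a : Vec A m) (b : Vec A n) → V.take m (a V.++ b) ≡ a × V.drop m (a V.++ b) ≡ b
take-drop-++ {m = m} a b = V.++-injective (V.take m (a V.++ b)) a (V.take++drop≡id m (a V.++ b))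

-- Polynomials over the field

module Polynomials {k : ℕ} (G : GF2k k) where
  open GF2k G
  open Field G

  ring : CommutativeRing _ _
  ring = record { isCommutativeRing = isCommRing }

  open CommutativeRing ring
    using (+-comm; +-identityˡ; +-identityʳ; -‿inverseʳ; distribˡ; distribʳ; zeroˡ; zeroʳ;
           *-comm; *-assoc; *-identityˡ; *-identityʳ)
  open CommutativeSemigroupProperties (CommutativeRing.+-commutativeSemigroup ring)
    using (interchange)
  open CommutativeSemigroupProperties (CommutativeRing.*-commutativeSemigroup ring)
    using (x∙yz≈y∙xz)
  open GroupProperties (CommutativeRing.+-group ring) using (\\-leftDividesˡ)
  open GroupProperties (CommutativeRing.+-group ring) public using (x∙y⁻¹≈ε⇒x≈y; ∙-cancelˡ)

  _+ₚ_ : ∀ {d} → Poly k d → Poly k d → Poly k d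
  _+ₚ_ = V.zipWith _⊕_

  evalP-+ₚ : ∀ {d} (p q : Poly k d) x → evalP (p +ₚ q) x ≡ evalP p x ⊕ evalP q x
  evalP-+ₚ []      []      x = sym (+-identityˡ 0v)
  evalP-+ₚ (a ∷ p) (b ∷ q) x = begin
    (a ⊕ b) ⊕ (x · evalP (p +ₚ q) x)                   ≡⟨ cong (λ z → (a ⊕ b) ⊕ (x · z)) (evalP-+ₚ p q x) ⟩
    (a ⊕ b) ⊕ (x · (evalP p x ⊕ evalP q x))            ≡⟨ cong ((a ⊕ b) ⊕_) (distribˡ x (evalP p x) (evalP q x)) ⟩
    (a ⊕ b) ⊕ ((x · evalP p x) ⊕ (x · evalP q x))      ≡⟨ interchange a b _ _ ⟩
    (a ⊕ (x · evalP p x)) ⊕ (b ⊕ (x · evalP q x))      ∎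
    where open ≡-Reasoning

  dec-⊕ : ∀ {d} (u v : Vec Bool (d ℕ.* k)) → dec {d} (u ⊕ v) ≡ dec {d} u +ₚ dec {d} v
  dec-⊕ {zero}  u v = refl
  dec-⊕ {suc d} u v = cong₂ _∷_ (V.take-zipWith _xor_ u v)
    (trans (cong (dec {d}) (V.drop-zipWith _xor_ u v)) (dec-⊕ {d} (V.drop k u) (V.drop k v)))

  evalP-dec-⊕ : ∀ {d} (u v : Vec Bool (d ℕ.* k)) x →
                evalP (dec {d} (u ⊕ v)) x ≡ evalP (dec {d} u) x ⊕ evalP (dec {d} v) x
  evalP-dec-⊕ {d} u v x = trans (cong (λ p → evalP p x) (dec-⊕ {d} u v)) (evalP-+ₚ (dec {d} u) (dec {d} v) x)

  dec-enc : ∀ {d} (f : Poly k d) → dec {d} (enc f) ≡ f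
  dec-enc []      = refl
  dec-enc (a ∷ f) = cong₂ _∷_ (proj₁ (take-drop-++ a (enc f)))
    (trans (cong dec (proj₂ (take-drop-++ a (enc f)))) (dec-enc f))

  dot-EvalCol : ∀ d (v : Vec Bool (d ℕ.* k)) x c → dot v (EvalCol d x c) ≡ V.lookup (evalP (dec {d} v) x) c
  dot-EvalCol d v x c = sym (additive⇒dot coordinate coordinate-⊕ v)
    where
    coordinate : Vec Bool (d ℕ.* k) → Bool
    coordinate u = V.lookup (evalP (dec {d} u) x) c
    coordinate-⊕ : Additive coordinate
    coordinate-⊕ u w = trans (cong (λ z → V.lookup z c) (evalP-dec-⊕ {d} u w x))
      (V.lookup-zipWith _xor_ c (evalP (dec {d} u) x) (evalP (dec {d} w) x))

  evalP-zeros : ∀ n x → evalP (V.replicate n 0v) x ≡ 0v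
  evalP-zeros zero    x = refl
  evalP-zeros (suc n) x = trans (+-identityˡ _) (trans (cong (x ·_) (evalP-zeros n x)) (zeroʳ x))

  evalP-padRight : ∀ {n d} (n≤d : n ℕ.≤ d) (p : Poly k n) x → evalP (V.padRight n≤d 0v p) x ≡ evalP p x
  evalP-padRight {d = d} z≤n []      x = evalP-zeros d x
  evalP-padRight (s≤s n≤d)   (a ∷ p) x = cong (λ z → a ⊕ (x · z)) (evalP-padRight n≤d p x)

  scaleP : ∀ {n} → F k → Poly k n → Poly k n
  scaleP c = V.map (c ·_)

  evalP-scaleP : ∀ {n} c (p : Poly k n) x → evalP (scaleP c p) x ≡ c · evalP p x
  evalP-scaleP c []      x = sym (zeroʳ c)
  evalP-scaleP c (a ∷ p) x = begin
    (c · a) ⊕ (x · evalP (scaleP c p) x)     ≡⟨ cong (λ z → (c · a) ⊕ (x · z)) (evalP-scaleP c p x) ⟩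
    (c · a) ⊕ (x · (c · evalP p x))          ≡⟨ cong ((c · a) ⊕_) (x∙yz≈y∙xz x c (evalP p x)) ⟩
    (c · a) ⊕ (c · (x · evalP p x))          ≡⟨ distribˡ c a _ ⟨
    c · (a ⊕ (x · evalP p x))                ∎
    where open ≡-Reasoning

  -- (Z - a) · p, which in characteristic 2 is (Z + a) · p
  mulLinear : ∀ {n} → F k → Poly k n → Poly k (suc n)
  mulLinear {n} a p = (0v ∷ p) +ₚ scaleP a (V.padRight (ℕ.n≤1+n n) 0v p)

  evalP-mulLinear : ∀ {n} a (p : Poly k n) x → evalP (mulLinear a p) x ≡ (x ⊕ a) · evalP p x
  evalP-mulLinear {n} a p x = begin
    evalP (mulLinear a p) x
      ≡⟨ evalP-+ₚ (0v ∷ p) (scaleP a (V.padRight (ℕ.n≤1+n n) 0v p)) x ⟩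
    (0v ⊕ (x · evalP p x)) ⊕ evalP (scaleP a (V.padRight (ℕ.n≤1+n n) 0v p)) x
      ≡⟨ cong₂ _⊕_ (+-identityˡ _)
               (trans (evalP-scaleP a (V.padRight (ℕ.n≤1+n n) 0v p) x)
                      (cong (a ·_) (evalP-padRight (ℕ.n≤1+n n) p x))) ⟩
    (x · evalP p x) ⊕ (a · evalP p x)
      ≡⟨ distribʳ (evalP p x) x a ⟨
    (x ⊕ a) · evalP p x
      ∎
    where open ≡-Reasoning

  vanishingPoly : (xs : List (F k)) → Poly k (suc (length xs))
  vanishingPoly []       = 𝟙 ∷ []
  vanishingPoly (a ∷ xs) = mulLinear a (vanishingPoly xs)

  x·y≡0⇒y≡0 : ∀ x y → x ≢ 0v → x · y ≡ 0v → y ≡ 0v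
  x·y≡0⇒y≡0 x y x≢0 xy≡0 = begin
    y                   ≡⟨ *-identityˡ y ⟨
    𝟙 · y               ≡⟨ cong (_· y) (trans (*-comm x⁻¹ x) (proj₂ (inverse x x≢0))) ⟨
    (x⁻¹ · x) · y       ≡⟨ *-assoc x⁻¹ x y ⟩
    x⁻¹ · (x · y)       ≡⟨ cong (x⁻¹ ·_) xy≡0 ⟩
    x⁻¹ · 0v            ≡⟨ zeroʳ x⁻¹ ⟩
    0v                  ∎
    where
    open ≡-Reasoning
    x⁻¹ : F k
    x⁻¹ = proj₁ (inverse x x≢0)

  evalP-vanishingPoly-∈ : ∀ xs x → x ∈ xs → evalP (vanishingPoly xs) x ≡ 0v
  evalP-vanishingPoly-∈ (a ∷ xs) x (here refl) = begin
    evalP (mulLinear x (vanishingPoly xs)) x      ≡⟨ evalP-mulLinear x (vanishingPoly xs) x ⟩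
    (x ⊕ x) · evalP (vanishingPoly xs) x          ≡⟨ cong (_· evalP (vanishingPoly xs) x) (-‿inverseʳ x) ⟩
    0v · evalP (vanishingPoly xs) x               ≡⟨ zeroˡ _ ⟩
    0v                                            ∎
    where open ≡-Reasoning
  evalP-vanishingPoly-∈ (a ∷ xs) x (there x∈xs) = begin
    evalP (mulLinear a (vanishingPoly xs)) x      ≡⟨ evalP-mulLinear a (vanishingPoly xs) x ⟩
    (x ⊕ a) · evalP (vanishingPoly xs) x          ≡⟨ cong ((x ⊕ a) ·_) (evalP-vanishingPoly-∈ xs x x∈xs) ⟩
    (x ⊕ a) · 0v                                  ≡⟨ zeroʳ _ ⟩
    0v                                            ∎
    where open ≡-Reasoning

  evalP-vanishingPoly-∉ : ∀ xs x → All (x ≢_) xs → evalP (vanishingPoly xs) x ≢ 0v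
  evalP-vanishingPoly-∉ []       x []           eq =
    𝟙≢0 (trans (sym (trans (cong (𝟙 ⊕_) (zeroʳ x)) (+-identityʳ 𝟙))) eq)
  evalP-vanishingPoly-∉ (a ∷ xs) x (x≢a ∷ x∉xs) eq =
    evalP-vanishingPoly-∉ xs x x∉xs
      (x·y≡0⇒y≡0 (x ⊕ a) _ (x≢a ∘ x∙y⁻¹≈ε⇒x≈y x a) (trans (sym (evalP-mulLinear a (vanishingPoly xs) x)) eq))

  valuesAt : ∀ {d} → Poly k d → (xs : List (F k)) → Vec (F k) (length xs)
  valuesAt W xs = V.map (evalP W) (V.fromList xs)

  valuesAt-cong : ∀ {d} (W W′ : Poly k d) xs → All (λ x → evalP W x ≡ evalP W′ x) xs →
                  valuesAt W xs ≡ valuesAt W′ xs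
  valuesAt-cong W W′ []       []                = refl
  valuesAt-cong W W′ (x ∷ xs) (W[x]≡W′[x] ∷ eqs) = cong₂ _∷_ W[x]≡W′[x] (valuesAt-cong W W′ xs eqs)

  -- Newton's step: correct the interpolant of xs at the new point x by a multiple of ∏_{a ∈ xs} (Z - a).
  interpolate : ∀ {d} xs → Unique xs → length xs ℕ.≤ d → (ys : Vec (F k) (length xs)) →
                Σ[ W ∈ Poly k d ] valuesAt W xs ≡ ys
  interpolate {d} []       []           _   []       = V.replicate d 0v , refl
  interpolate {d} (x ∷ xs) (x∉xs ∷ !xs) n≤d (y ∷ ys) =
    W , cong₂ _∷_ W[x]≡y (trans (valuesAt-cong W W₀ xs W≡W₀-on-xs) W₀[xs]≡ys)
    where
    W₀ : Poly k d
    W₀ = proj₁ (interpolate xs !xs (ℕ.≤-trans (ℕ.n≤1+n _) n≤d) ys)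
    W₀[xs]≡ys : valuesAt W₀ xs ≡ ys
    W₀[xs]≡ys = proj₂ (interpolate xs !xs (ℕ.≤-trans (ℕ.n≤1+n _) n≤d) ys)
    N : Poly k d
    N = V.padRight n≤d 0v (vanishingPoly xs)
    N[x]≢0 : evalP N x ≢ 0v
    N[x]≢0 = evalP-vanishingPoly-∉ xs x x∉xs ∘ trans (sym (evalP-padRight n≤d (vanishingPoly xs) x))
    N[x]⁻¹ : F k
    N[x]⁻¹ = proj₁ (inverse (evalP N x) N[x]≢0)
    c : F k
    c = (y ⊕ evalP W₀ x) · N[x]⁻¹
    W : Poly k d
    W = W₀ +ₚ scaleP c N
    W≡W₀-on-xs : All (λ x′ → evalP W x′ ≡ evalP W₀ x′) xs
    W≡W₀-on-xs = All.tabulate λ {x′} x′∈xs → begin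
      evalP W x′                       ≡⟨ evalP-+ₚ W₀ (scaleP c N) x′ ⟩
      evalP W₀ x′ ⊕ evalP (scaleP c N) x′
        ≡⟨ cong (evalP W₀ x′ ⊕_) (evalP-scaleP c N x′) ⟩
      evalP W₀ x′ ⊕ (c · evalP N x′)
        ≡⟨ cong (λ z → evalP W₀ x′ ⊕ (c · z))
                (trans (evalP-padRight n≤d (vanishingPoly xs) x′) (evalP-vanishingPoly-∈ xs x′ x′∈xs)) ⟩
      evalP W₀ x′ ⊕ (c · 0v)           ≡⟨ cong (evalP W₀ x′ ⊕_) (zeroʳ c) ⟩
      evalP W₀ x′ ⊕ 0v                 ≡⟨ +-identityʳ _ ⟩
      evalP W₀ x′                      ∎
      where open ≡-Reasoning
    c·N[x]≡y⊕W₀[x] : c · evalP N x ≡ y ⊕ evalP W₀ x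
    c·N[x]≡y⊕W₀[x] = begin
      ((y ⊕ evalP W₀ x) · N[x]⁻¹) · evalP N x    ≡⟨ *-assoc _ N[x]⁻¹ (evalP N x) ⟩
      (y ⊕ evalP W₀ x) · (N[x]⁻¹ · evalP N x)    ≡⟨ cong ((y ⊕ evalP W₀ x) ·_) (*-comm N[x]⁻¹ (evalP N x)) ⟩
      (y ⊕ evalP W₀ x) · (evalP N x · N[x]⁻¹)
        ≡⟨ cong ((y ⊕ evalP W₀ x) ·_) (proj₂ (inverse (evalP N x) N[x]≢0)) ⟩
      (y ⊕ evalP W₀ x) · 𝟙                       ≡⟨ *-identityʳ _ ⟩
      y ⊕ evalP W₀ x                             ∎
      where open ≡-Reasoning
    W[x]≡y : evalP W x ≡ y
    W[x]≡y = begin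
      evalP W x                              ≡⟨ evalP-+ₚ W₀ (scaleP c N) x ⟩
      evalP W₀ x ⊕ evalP (scaleP c N) x
        ≡⟨ cong (evalP W₀ x ⊕_) (trans (evalP-scaleP c N x) c·N[x]≡y⊕W₀[x]) ⟩
      evalP W₀ x ⊕ (y ⊕ evalP W₀ x)          ≡⟨ cong (evalP W₀ x ⊕_) (+-comm y (evalP W₀ x)) ⟩
      evalP W₀ x ⊕ (evalP W₀ x ⊕ y)          ≡⟨ \\-leftDividesˡ (evalP W₀ x) y ⟩
      y                                      ∎
      where open ≡-Reasoning

-- Flipping the bits 𝓑 by a linear functional of the columns of 𝓜

flipBits : Vec Bool m → State m → State m
flipBits w = L.map (λ (c , b) → c , b xor dot w c)

colsOf-flipBits : (w : Vec Bool m) (st : State m) → colsOf (flipBits w st) ≡ colsOf st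
colsOf-flipBits w []            = refl
colsOf-flipBits w ((c , b) ∷ st) = cong (c ∷_) (colsOf-flipBits w st)

InA : State m → Vec Bool m → Set
InA st v = All (λ (c , b) → dot v c ≡ b) st

InA-flipBits : (w : Vec Bool m) (st : State m) (v : Vec Bool m) → InA (flipBits w st) v → InA st (v ⊕ w)
InA-flipBits w []             v []       = []
InA-flipBits w ((c , b) ∷ st) v (vc≡b′ ∷ rest) =
  trans (dot-⊕ˡ v w c) (trans (cong (_xor dot w c) vc≡b′) (xor-cancelʳ b (dot w c))) ∷ InA-flipBits w st v rest

InA-⊕-⟂ : (st : State m) (u u′ : Vec Bool m) → InA st u → InA st u′ → (u ⊕ u′) ⟂ colsOf st
InA-⊕-⟂ []             u u′ []             []               = []
InA-⊕-⟂ ((c , b) ∷ st) u u′ (uc≡b ∷ u∈A) (u′c≡b ∷ u′∈A) =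
  trans (dot-⊕ˡ u u′ c) (trans (cong₂ _xor_ uc≡b u′c≡b) (xor-same b)) ∷ InA-⊕-⟂ st u u′ u∈A u′∈A

Equivariant : Vec Bool m → (State m → Dist (State m)) → Set
Equivariant w h = ∀ st g → 𝔼 (h (flipBits w st)) g ≡ 𝔼 (h st) (g ∘ flipBits w)

ret-equivariant : (w : Vec Bool m) → Equivariant w ret
ret-equivariant w st g = trans (𝔼-ret (flipBits w st) g) (sym (𝔼-ret st (g ∘ flipBits w)))

bind-equivariant : (w : Vec Bool m) {h₁ h₂ : State m → Dist (State m)} →
                   Equivariant w h₁ → Equivariant w h₂ → Equivariant w (λ st → bind (h₁ st) h₂)
bind-equivariant w {h₁} {h₂} h₁-eq h₂-eq st g = begin
  𝔼 (bind (h₁ (flipBits w st)) h₂) g                ≡⟨ 𝔼-bind (h₁ (flipBits w st)) h₂ g ⟩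
  𝔼 (h₁ (flipBits w st)) (λ s → 𝔼 (h₂ s) g)          ≡⟨ h₁-eq st _ ⟩
  𝔼 (h₁ st) (λ s → 𝔼 (h₂ (flipBits w s)) g)         ≡⟨ 𝔼-cong (h₁ st) (λ s → h₂-eq s g) ⟩
  𝔼 (h₁ st) (λ s → 𝔼 (h₂ s) (g ∘ flipBits w))       ≡⟨ 𝔼-bind (h₁ st) h₂ _ ⟨
  𝔼 (bind (h₁ st) h₂) (g ∘ flipBits w)              ∎
  where open ≡-Reasoning

coin : Dist Bool
coin = uniform false (true ∷ [])

𝔼-coin-xor : (a : Bool) (h : Bool → ℚ) → 𝔼 coin (λ b → h (b xor a)) ≡ 𝔼 coin h
𝔼-coin-xor false h = refl
𝔼-coin-xor true  h = solve 3 (λ x y z → x :+ (y :+ z) := y :+ (x :+ z)) refl (½ * h true) (½ * h false) 0ℚ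
  where
  ½ : ℚ
  ½ = + 1 / 2

𝔼-extend : (st : State m) (c : Vec Bool m) (cs : List (Vec Bool m)) (g : State m → ℚ) →
           𝔼 (extend st (c ∷ cs)) g ≡ 𝔼 (uniform c cs) (λ col → 𝔼 coin (λ b → g (st ++ [ (col , b) ])))
𝔼-extend st c cs g = trans (𝔼-bind (uniform c cs) (λ col → bind coin (appendTo col)) g)
  (𝔼-cong (uniform c cs) λ col →
    trans (𝔼-bind coin (appendTo col) g) (𝔼-cong coin (λ b → 𝔼-ret (st ++ [ (col , b) ]) g)))
  where
  appendTo : Vec Bool _ → Bool → Dist (State _)
  appendTo col b = ret (st ++ [ (col , b) ])

-- a uniformly random bit is invariant under xor with the fixed bit dot w col
extend-equivariant : (w : Vec Bool m) (cs : List (Vec Bool m)) → Equivariant w (λ st → extend st cs)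
extend-equivariant w []       = ret-equivariant w
extend-equivariant w (c ∷ cs) st g = begin
  𝔼 (extend (flipBits w st) (c ∷ cs)) g
    ≡⟨ 𝔼-extend (flipBits w st) c cs g ⟩
  𝔼 (uniform c cs) (λ col → 𝔼 coin (λ b → g (flipBits w st ++ [ (col , b) ])))
    ≡⟨ 𝔼-cong (uniform c cs) (λ col → trans (𝔼-cong coin (λ b → cong g (unflip col b)))
                   (𝔼-coin-xor (dot w col) (λ b → g (flipBits w (st ++ [ (col , b) ]))))) ⟩
  𝔼 (uniform c cs) (λ col → 𝔼 coin (λ b → g (flipBits w (st ++ [ (col , b) ]))))
    ≡⟨ 𝔼-extend st c cs (g ∘ flipBits w) ⟨
  𝔼 (extend st (c ∷ cs)) (g ∘ flipBits w)
    ∎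
  where
  open ≡-Reasoning
  unflip : ∀ col b → flipBits w st ++ [ (col , b) ] ≡ flipBits w (st ++ [ (col , b xor dot w col) ])
  unflip col b = sym (trans (map-++ _ st _)
    (cong (λ b′ → flipBits w st ++ [ (col , b′) ]) (xor-cancelʳ b (dot w col))))

extend-nonNeg : (st : State m) (cs : List (Vec Bool m)) → NonNegWeights (extend st cs)
extend-nonNeg st []       = ret-nonNeg st
extend-nonNeg st (c ∷ cs) = bind-nonNeg (uniform c cs) _ (uniform-nonNeg c cs) λ col →
  bind-nonNeg coin _ (uniform-nonNeg false (true ∷ [])) (λ b → ret-nonNeg (st ++ [ (col , b) ]))

module ProcedureProperties {k : ℕ} (G : GF2k k) (d : ℕ) where
  open Field G
  open Procedure G d
  open Polynomials G

  candidates : State (d ℕ.* k) → F k → List (Vec Bool (d ℕ.* k))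
  candidates st x = L.filterᵇ (λ c → not (inSpan (colsOf st) c)) (EvalBarCols d x)

  step-equivariant : ∀ w x → Equivariant w (step x)
  step-equivariant w x st g rewrite colsOf-flipBits w st = extend-equivariant w (candidates st x) st g

  repeatStep-equivariant : ∀ w r x → Equivariant w (repeatStep r x)
  repeatStep-equivariant w zero    x = ret-equivariant w
  repeatStep-equivariant w (suc r) x =
    bind-equivariant w {step x} {repeatStep r x} (step-equivariant w x) (repeatStep-equivariant w r x)

  runRows-equivariant : ∀ w r xs → Equivariant w (runRows r xs)
  runRows-equivariant w r []       = ret-equivariant w
  runRows-equivariant w r (x ∷ xs) =
    bind-equivariant w {repeatStep r x} {runRows r xs} (repeatStep-equivariant w r x) (runRows-equivariant w r xs)

  𝔼-R-flipBits : ∀ w ι r (g : State (d ℕ.* k) → ℚ) → 𝔼 (R ι r) (g ∘ flipBits w) ≡ 𝔼 (R ι r) g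
  𝔼-R-flipBits w ι r g = sym (runRows-equivariant w r (L.map (Inverse.to ι) (L.allFin _)) [] g)

  step-nonNeg : ∀ x st → NonNegWeights (step x st)
  step-nonNeg x st = extend-nonNeg st (candidates st x)

  repeatStep-nonNeg : ∀ r x st → NonNegWeights (repeatStep r x st)
  repeatStep-nonNeg zero    x st = ret-nonNeg st
  repeatStep-nonNeg (suc r) x st = bind-nonNeg (step x st) _ (step-nonNeg x st) (repeatStep-nonNeg r x)

  runRows-nonNeg : ∀ r xs st → NonNegWeights (runRows r xs st)
  runRows-nonNeg r []       st = ret-nonNeg st
  runRows-nonNeg r (x ∷ xs) st =
    bind-nonNeg (repeatStep r x st) _ (repeatStep-nonNeg r x st) (runRows-nonNeg r xs)

  R-nonNeg : ∀ ι r → NonNegWeights (R ι r)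
  R-nonNeg ι r = runRows-nonNeg r (L.map (Inverse.to ι) (L.allFin _)) []

  T-inA : ∀ st v → T (inA st v) → InA st v
  T-inA st v v∈A = All.map toWitness (T-allB _ st v∈A)

  compact⇒agree : ∀ st x u u′ → T (compact st x) → InA st u → InA st u′ →
                  evalP (dec {d} u) x ≡ evalP (dec {d} u′) x
  compact⇒agree st x u u′ x-compact u∈A u′∈A =
    x∙y⁻¹≈ε⇒x≈y (evalP (dec {d} u) x) (evalP (dec {d} u′) x)
      (trans (sym (evalP-dec-⊕ {d} u u′ x)) (lookup-false⇒0v _ coordinate-false))
    where
    coordinate-false : ∀ c → V.lookup (evalP (dec {d} (u ⊕ u′)) x) c ≡ false
    coordinate-false c = trans (sym (dot-EvalCol d (u ⊕ u′) x c))
      (⟂-inSpan (u ⊕ u′) (colsOf st) (EvalCol d x c) (InA-⊕-⟂ st u u′ u∈A u′∈A)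
                (All.lookup (T-allB _ (L.allFin k) x-compact) (∈-allFin c)))

  -- abstracting over mon i j lets the zero test inside survives compute
  survives⇒notInS0 : ∀ ι mon st i j → T (survives ι mon st) → mon i j ≢ 0 →
                     T (notInS0 st (Inverse.to ι i) (Inverse.to ι j))
  survives⇒notInS0 ι mon st i j surv mij≢0
    with mon i j | mij≢0 | All.lookup (T-allB _ _ (All.lookup (T-allB _ _ surv) (∈-allFin i))) (∈-allFin j)
  ... | zero  | 0≢0 | _       = ⊥-elim (0≢0 refl)
  ... | suc _ | _   | notInS0 = notInS0

  notInS0⇒witness : ∀ st x y → T (notInS0 st x y) → Σ[ f ∈ Poly k d ] InA st (enc f) × evalP f x ≡ y
  notInS0⇒witness st x y h with satisfied (T-anyB _ (allVecOf (allVec k) d) h)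
  ... | f , f∈A∧f[x]≡y =
    f , T-inA st (enc f) (proj₁ (to T-∧ f∈A∧f[x]≡y)) , T-≟V (proj₂ (to T-∧ f∈A∧f[x]≡y))

module SurvivalBound {k : ℕ} (G : GF2k k) (d r : ℕ) (ι : Fin (2 ^ k) ↔ F k)
             (mon : Fin (2 ^ k) → Fin (2 ^ k) → ℕ) (rows : List (Fin (2 ^ k)))
             (!rows : Unique rows) (rows≤d : length rows ℕ.≤ d)
             (mon-meets-rows : All (λ i → ∃ (λ j → mon i j ≢ 0)) rows) where
  open Field G
  open Procedure G d
  open Polynomials G
  open ProcedureProperties G d

  x[_] : Fin (2 ^ k) → F k
  x[_] = Inverse.to ι

  points : List (F k)
  points = L.map x[_] rows

  Values : Set
  Values = Vec (F k) (length points)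

  points≤d : length points ℕ.≤ d
  points≤d = subst (ℕ._≤ d) (sym (length-map x[_] rows)) rows≤d

  interpolation : ∀ ys → Σ[ W ∈ Poly k d ] valuesAt W points ≡ ys
  interpolation = interpolate points (Unique.map⁺ (Injection.injective (↔⇒↣ ι)) !rows) points≤d

  interpolant : Values → Poly k d
  interpolant ys = proj₁ (interpolation ys)

  shift : Values → Vec Bool (d ℕ.* k)
  shift ys = enc (interpolant ys)

  Event : State (d ℕ.* k) → Bool
  Event st = survives ι mon st ∧ allCompact ι rows st

  Shifted : Values → State (d ℕ.* k) → Bool
  Shifted ys st = Event (flipBits (shift ys) st)

  allCompact-flipBits : ∀ w st → allCompact ι rows (flipBits w st) ≡ allCompact ι rows st
  allCompact-flipBits w st =
    cong (λ cs → allB (λ i → allB (λ c → inSpan cs (EvalCol d x[ i ] c)) (L.allFin k)) rows)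
         (colsOf-flipBits w st)

  shifted-solution : ∀ st ys i j → mon i j ≢ 0 → T (survives ι mon (flipBits (shift ys) st)) →
    Σ[ u ∈ Vec Bool (d ℕ.* k) ] InA st u × evalP (dec {d} u) x[ i ] ≡ x[ j ] ⊕ evalP (interpolant ys) x[ i ]
  shifted-solution st ys i j mij≢0 surv
    with notInS0⇒witness (flipBits (shift ys) st) x[ i ] x[ j ]
           (survives⇒notInS0 ι mon (flipBits (shift ys) st) i j surv mij≢0)
  ... | f , f∈A , f[x]≡y = enc f ⊕ shift ys , InA-flipBits (shift ys) st (enc f) f∈A , (begin
    evalP (dec {d} (enc f ⊕ shift ys)) x[ i ]
      ≡⟨ evalP-dec-⊕ {d} (enc f) (shift ys) x[ i ] ⟩
    evalP (dec {d} (enc f)) x[ i ] ⊕ evalP (dec {d} (shift ys)) x[ i ]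
      ≡⟨ cong₂ (λ p q → evalP p x[ i ] ⊕ evalP q x[ i ]) (dec-enc f) (dec-enc (interpolant ys)) ⟩
    evalP f x[ i ] ⊕ evalP (interpolant ys) x[ i ]
      ≡⟨ cong (_⊕ evalP (interpolant ys) x[ i ]) f[x]≡y ⟩
    x[ j ] ⊕ evalP (interpolant ys) x[ i ]
      ∎)
    where open ≡-Reasoning

  shifted-unique : ∀ st → T (allCompact ι rows st) →
                   ∀ {ys ys′} → T (Shifted ys st) → T (Shifted ys′ st) → ys ≡ ys′
  shifted-unique st rows-compact {ys} {ys′} shifted shifted′ = begin
    ys                              ≡⟨ proj₂ (interpolation ys) ⟨
    valuesAt (interpolant ys) points
      ≡⟨ valuesAt-cong (interpolant ys) (interpolant ys′) points (All.map⁺ (All.tabulate agree)) ⟩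
    valuesAt (interpolant ys′) points ≡⟨ proj₂ (interpolation ys′) ⟩
    ys′                             ∎
    where
    open ≡-Reasoning
    agree : ∀ {i} → i ∈ rows → evalP (interpolant ys) x[ i ] ≡ evalP (interpolant ys′) x[ i ]
    agree {i} i∈rows with All.lookup mon-meets-rows i∈rows
    ... | j , mij≢0
      with shifted-solution st ys i j mij≢0 (proj₁ (to T-∧ shifted))
         | shifted-solution st ys′ i j mij≢0 (proj₁ (to T-∧ shifted′))
    ... | u , u∈A , u[x]≡ | u′ , u′∈A , u′[x]≡ = ∙-cancelˡ x[ j ] _ _
      (trans (sym u[x]≡) (trans (compact⇒agree st x[ i ] u u′ i-compact u∈A u′∈A) u′[x]≡))
      where
      i-compact : T (compact st x[ i ])
      i-compact = All.lookup (T-allB _ rows rows-compact) i∈rows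

  tuples : List Values
  tuples = allVecOf (allVec k) (length points)

  length-tuples : length tuples ≡ (2 ^ k) ^ length rows
  length-tuples = trans (length-allVecOf (allVec k) (length points))
    (cong₂ _^_ (length-allVecOf (false ∷ true ∷ []) k) (length-map x[_] rows))

  ∑-Shifted≤allCompact : ∀ st → ∑ tuples (λ ys → indicator (Shifted ys st)) ≤ indicator (allCompact ι rows st)
  ∑-Shifted≤allCompact st with allCompact ι rows st in rows-compact
  ... | true  =
    ∑-indicator≤1 (λ ys → Shifted ys st) tuples !tuples (shifted-unique st (subst T (sym rows-compact) _))
    where
    !tuples : Unique tuples
    !tuples = allVecOf-unique (allVec k) (length points)
                (allVecOf-unique (false ∷ true ∷ []) k (((λ ()) ∷ []) ∷ [] ∷ []))
  ... | false = ℚ.≤-reflexive (∑-indicator-none (λ ys → Shifted ys st) tuples (All.universal noncompact tuples))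
    where
    noncompact : ∀ ys → ¬ T (Shifted ys st)
    noncompact ys shifted =
      subst T (trans (allCompact-flipBits (shift ys) st) rows-compact) (proj₂ (to T-∧ shifted))

  𝔼-Shifted : ∀ ys → 𝔼 (R ι r) (indicator ∘ Shifted ys) ≡ Pr (R ι r) Event
  𝔼-Shifted ys = trans (𝔼-R-flipBits (shift ys) ι r (indicator ∘ Event)) (sym (Pr≡𝔼-indicator (R ι r) Event))

  bound : Pr (R ι r) Event * fromℕ ((2 ^ k) ^ length rows) ≤ Pr (R ι r) (allCompact ι rows)
  bound = begin
    Pr D Event * fromℕ ((2 ^ k) ^ length rows)             ≡⟨ ℚ.*-comm (Pr D Event) _ ⟩
    fromℕ ((2 ^ k) ^ length rows) * Pr D Event             ≡⟨ cong (λ n → fromℕ n * Pr D Event) length-tuples ⟨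
    fromℕ (length tuples) * Pr D Event                     ≡⟨ ∑-const tuples (Pr D Event) ⟨
    ∑ tuples (λ _ → Pr D Event)                            ≡⟨ ∑-cong tuples 𝔼-Shifted ⟨
    ∑ tuples (λ ys → 𝔼 D (indicator ∘ Shifted ys))         ≡⟨ 𝔼-∑ D tuples (λ ys → indicator ∘ Shifted ys) ⟨
    𝔼 D (λ st → ∑ tuples (λ ys → indicator (Shifted ys st))) ≤⟨ 𝔼-mono D (R-nonNeg ι r) ∑-Shifted≤allCompact ⟩
    𝔼 D (indicator ∘ allCompact ι rows)                    ≡⟨ Pr≡𝔼-indicator D (allCompact ι rows) ⟨
    Pr D (allCompact ι rows)                               ∎
    where
    open ℚ.≤-Reasoning
    D : Dist (State (d ℕ.* k))
    D = R ι r

lemma5p11 : (k d r t : ℕ) (G : GF2k k) (ι : Fin (2 ^ k) ↔ F k)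
    (m : Fin (2 ^ k) → Fin (2 ^ k) → ℕ) (T : List (Fin (2 ^ k))) →
    Unique T → length T ≡ t → t < d ∸ 1 →
    All (λ i → ∃ (λ j → m i j ≢ 0)) T →
    let open Procedure G d in
    Pr (R ι r) (λ st → survives ι m st ∧ allCompact ι T st) * ((+ ((2 ^ k) ^ t)) / 1)
      ≤ Pr (R ι r) (allCompact ι T)
lemma5p11 k d r _ G ι m rows !rows refl t<d∸1 m-meets-rows =
  SurvivalBound.bound G d r ι m rows !rows (ℕ.≤-trans (ℕ.<⇒≤ t<d∸1) (ℕ.m∸n≤m d 1)) m-meets-rows
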